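{- Let \[ G(x)=\sum_{n=1}^\infty\sum_{c=0}^n (x)_n\,x^{n-1}\,q^{c^2}\,x^{2c}\begin{bmatrix} n\\ c\end{bmatrix}. \] Then, as formal power series in $q$ whose coefficients are formal Laurent series in $x$, \[ G(x)=(qx)_\infty\sum_{c=0}^\infty\frac{q^{c^2}}{(qx)_c}x^{3c-1}-(1-x)x^{ -1}(qx)_\infty+(1-x)\sum_{n=1}^\infty\sum_{c=0}^n\big((qx)_{n-1}-(qx)_\infty\big)x^{n-1}q^{c^2}x^{2c}\begin{bmatrix} n\\ c\end{bmatrix}. \]
   Context: Notation: $(x)_n=(x;q)_n=\prod_{i=1}^n(1-xq^{i-1})$, $(x)_\infty=\prod_{i\ge1}(1-xq^{i-1})$, and $\begin{bmatrix} n\\ c\end{bmatrix}=\frac{(q)_n}{(q)_c(q)_{n-c}}$ for $0\le c\le n$ and $0$ otherwise. -}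

module Defs where

open import Data.Nat as ℕ using (ℕ; zero; suc)
open import Data.Integer as ℤ using (ℤ; +_; -[1+_])
open import Data.List using (List; []; _∷_; _++_; map; concatMap)
open import Relation.Nullary using (yes; no)

-- A monomial  coef · q^qe · x^xe  (q-exponent natural, x-exponent integer:
-- coefficients in q are Laurent in x).
record Mono : Set where
  constructor mono
  field
    coef : ℤ
    qe   : ℕ
    xe   : ℤ

Poly : Set
Poly = List Mono

coeff : ℕ → ℤ → Poly → ℤ
coeff N m [] = + 0
coeff N m (mono a i j ∷ p) with i ℕ.≟ N | j ℤ.≟ m
... | yes _ | yes _ = a ℤ.+ coeff N m p
... | _     | _     = coeff N m p

0P : Poly
0P = []

1P : Poly
1P = mono (+ 1) 0 (+ 0) ∷ []

infixl 6 _⊕_ _⊖_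
infixl 7 _⊗_

_⊕_ : Poly → Poly → Poly
p ⊕ r = p ++ r

neg : Poly → Poly
neg = map (λ { (mono a i j) → mono (ℤ.- a) i j })

_⊖_ : Poly → Poly → Poly
p ⊖ r = p ⊕ neg r

mulM : Mono → Mono → Mono
mulM (mono a i j) (mono b k l) = mono (a ℤ.* b) (i ℕ.+ k) (j ℤ.+ l)

_⊗_ : Poly → Poly → Poly
p ⊗ r = concatMap (λ a → map (mulM a) r) p

qpow : ℕ → Poly
qpow i = mono (+ 1) i (+ 0) ∷ []

xpow : ℤ → Poly
xpow j = mono (+ 1) 0 j ∷ []

X : Poly
X = xpow (+ 1)

sumR : ℕ → (ℕ → Poly) → Poly
sumR zero    f = 0P
sumR (suc n) f = sumR n f ⊕ f n

prodR : ℕ → (ℕ → Poly) → Poly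
prodR zero    f = 1P
prodR (suc n) f = prodR n f ⊗ f n

poch : Poly → ℕ → Poly
poch a n = prodR n (λ i → 1P ⊖ a ⊗ qpow i)

xP : ℕ → Poly
xP = poch X

qxP : ℕ → Poly
qxP = poch (qpow 1 ⊗ X)

-- Gaussian binomial [n c] (zero for c > n), via q-Pascal:
-- [n+1, c+1] = [n, c] + q^{c+1} [n, c+1].
gauss : ℕ → ℕ → Poly
gauss n       zero    = 1P
gauss zero    (suc c) = 0P
gauss (suc n) (suc c) = gauss n c ⊕ qpow (suc c) ⊗ gauss n (suc c)

-- Truncation at K of 1/(qx)_c = Π_{i=1}^c 1/(1 - q^i x),
-- each factor expanded as the geometric series Σ_{j=0}^{K} (q^i x)^j.
invQxP : ℕ → ℕ → Poly
invQxP K c = prodR c (λ i → sumR (suc K) (λ j → mono (+ 1) (suc i ℕ.* j) (+ j) ∷ []))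

-- summand  x^{n-1} q^{c^2} x^{2c} [n c]  (n ≥ 1 written as n = suc k)
core : ℕ → ℕ → Poly
core k c = xpow (+ k) ⊗ qpow (c ℕ.* c) ⊗ xpow (+ (2 ℕ.* c)) ⊗ gauss (suc k) c

-- K-th partial version of G(x): sums over 1 ≤ n ≤ K.
Gtrunc : ℕ → Poly
Gtrunc K = sumR K (λ k → sumR (suc (suc k)) (λ c → xP (suc k) ⊗ core k c))

-- K-th partial version of the right-hand side: infinite sums truncated at K,
-- (qx)_∞ replaced by (qx)_K, 1/(qx)_c by its K-truncated expansion.
RHStrunc : ℕ → Poly
RHStrunc K =
    qxP K ⊗ sumR (suc K) (λ c → qpow (c ℕ.* c) ⊗ invQxP K c ⊗ xpow ((+ (3 ℕ.* c)) ℤ.- (+ 1)))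
  ⊖ (1P ⊖ X) ⊗ xpow -[1+ 0 ] ⊗ qxP K
  ⊕ (1P ⊖ X) ⊗ sumR K (λ k → sumR (suc (suc k)) (λ c → (qxP k ⊖ qxP K) ⊗ core k c))

{-# OPTIONS --safe #-}
-- Since (x)_n = (1 - x)(qx)_{n-1} = (1 - x)((qx)_{n-1} - (qx)_∞) + (1 - x)(qx)_∞, the
-- first part of G is the last term of the right-hand side, and after multiplying by x
-- it remains to see that (1 - x) Σ_{n≥0} Σ_c x^n q^{c²} x^{2c} [n c] = Σ_c q^{c²} x^{3c} / (qx)_c.
-- Exchanging the sums, this is the generating function Σ_n [n c] x^n = x^c / (x)_{c+1},
-- which follows by induction on c from the q-Pascal rule [n+1, c+1] = [n, c] + q^{c+1} [n, c+1].
--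
-- For the truncations all of this holds exactly for the coefficients of q^Q x^L with
-- Q ≤ N and L ≤ M as soon as K ≥ N, M: replacing (qx)_∞ by (qx)_K and 1/(1 - q^i x) by a
-- geometric sum up to K only changes terms of q-degree > K, and cutting the sums over n
-- at K only changes terms of x-degree > K.  Such agreement is preserved by sums and by
-- multiplication with polynomials with nonnegative exponents.  Modulo equality of all
-- coefficients the finite sums of monomials form a commutative ring, in which the exact
-- steps are ring identities.
module Submission where

open import Defs
open import Data.Nat using (ℕ; _≤_)
open import Data.Integer using (ℤ)
open import Data.Product using (∃)
open import Relation.Binary.PropositionalEquality using (_≡_)

open import Data.Nat as ℕ using (zero; suc)
import Data.Nat.Properties as ℕP
open import Data.Integer as ℤ using (+_; -[1+_]; _+_; _-_; _*_; -_)
import Data.Integer.Properties as ℤP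
open import Data.Integer.Tactic.RingSolver using (solve-∀)
open import Data.List using ([]; _∷_; _++_; map)
import Data.List.Properties as ListP
open import Data.List.Relation.Unary.All as All using (All; []; _∷_)
import Data.List.Relation.Unary.All.Properties as AllP
open import Data.Maybe using (Maybe; just; nothing)
open import Data.Product using (_,_)
open import Relation.Nullary using (yes; no; contradiction)
open import Relation.Binary.PropositionalEquality
  using (refl; sym; trans; cong; cong₂; _≢_; module ≡-Reasoning)
open import Relation.Binary.Bundles using (Setoid)
import Relation.Binary.Reasoning.Setoid
open import Algebra.Bundles using (CommutativeRing)
open import Algebra.Structures using (IsCommutativeRing)
import Algebra.Solver.Ring.AlmostCommutativeRing as ACR
import Algebra.Solver.Ring as RingSolver

-- Opaque, so that a `with` on a decision between exponents cannot reach inside δ.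
opaque
  δ : ℤ → ℤ → ℤ
  δ x y with x ℤ.≟ y
  ... | yes _ = + 1
  ... | no  _ = + 0

  δ-≡ : ∀ {x y} → x ≡ y → δ x y ≡ + 1
  δ-≡ {x} {y} x≡y with x ℤ.≟ y
  ... | yes _   = refl
  ... | no  x≢y = contradiction x≡y x≢y

  δ-≢ : ∀ {x y} → x ≢ y → δ x y ≡ + 0
  δ-≢ {x} {y} x≢y with x ℤ.≟ y
  ... | yes x≡y = contradiction x≡y x≢y
  ... | no  _   = refl

  δ-shift : ∀ i k z → δ (i + k) z ≡ δ k (z - i)
  δ-shift i k z with i + k ℤ.≟ z | k ℤ.≟ z - i
  ... | yes _ | yes _ = refl
  ... | no  _ | no  _ = refl
  ... | yes e | no ne = contradiction (trans (sym (cancel i k)) (cong (_- i) e)) ne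
    where cancel : ∀ i k → i + k - i ≡ k
          cancel = solve-∀
  ... | no ne | yes e = contradiction (trans (cong (λ w → i + w) e) (cancel i z)) ne
    where cancel : ∀ i z → i + (z - i) ≡ z
          cancel = solve-∀

-- Coefficients are read off with integer exponents, so that multiplying by a
-- monomial is a shift of both exponents (a q-exponent below 0 has coefficient 0).
coeffMono : ℤ → ℤ → Mono → ℤ
coeffMono Q M (mono a i j) = a * δ (+ i) Q * δ j M

sumBy : (Mono → ℤ) → Poly → ℤ
sumBy g []      = + 0
sumBy g (a ∷ p) = g a + sumBy g p

coeffℤ : ℤ → ℤ → Poly → ℤ
coeffℤ Q M = sumBy (coeffMono Q M)

coeffMono-≡ : ∀ {Q M a i j} → + i ≡ Q → j ≡ M → coeffMono Q M (mono a i j) ≡ a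
coeffMono-≡ {Q} {M} {a} {i} {j} i≡Q j≡M = begin
  a * δ (+ i) Q * δ j M ≡⟨ cong₂ (λ u v → a * u * v) (δ-≡ i≡Q) (δ-≡ j≡M) ⟩
  a * + 1 * + 1         ≡⟨ trans (ℤP.*-identityʳ _) (ℤP.*-identityʳ a) ⟩
  a                     ∎
  where open ≡-Reasoning

coeffMono-≢ᵠ : ∀ {Q M a i j} → + i ≢ Q → coeffMono Q M (mono a i j) ≡ + 0
coeffMono-≢ᵠ {M = M} {a} {j = j} i≢Q = begin
  a * δ _ _ * δ j M ≡⟨ cong (λ u → a * u * δ j M) (δ-≢ i≢Q) ⟩
  a * + 0 * δ j M   ≡⟨ cong (_* δ j M) (ℤP.*-zeroʳ a) ⟩
  + 0 * δ j M       ≡⟨ ℤP.*-zeroˡ (δ j M) ⟩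
  + 0               ∎
  where open ≡-Reasoning

coeffMono-≢ˣ : ∀ {Q M a i j} → j ≢ M → coeffMono Q M (mono a i j) ≡ + 0
coeffMono-≢ˣ {Q} {a = a} {i} j≢M =
  trans (cong (a * δ (+ i) Q *_) (δ-≢ j≢M)) (ℤP.*-zeroʳ (a * δ (+ i) Q))

≡0⇒+-identityˡ : ∀ {x s} → x ≡ + 0 → x + s ≡ s
≡0⇒+-identityˡ x≡0 = trans (cong (_+ _) x≡0) (ℤP.+-identityˡ _)

coeff≡coeffℤ : ∀ N m p → coeff N m p ≡ coeffℤ (+ N) m p
coeff≡coeffℤ N m []               = refl
coeff≡coeffℤ N m (mono a i j ∷ p) with i ℕ.≟ N | j ℤ.≟ m
... | yes i≡N | yes j≡m =
  cong₂ _+_ (sym (coeffMono-≡ {+ N} {m} {a} (cong +_ i≡N) j≡m)) (coeff≡coeffℤ N m p)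
... | no i≢N | _ =
  trans (coeff≡coeffℤ N m p)
        (sym (≡0⇒+-identityˡ (coeffMono-≢ᵠ {+ N} {m} {a} (λ e → i≢N (ℤP.+-injective e)))))
... | yes _ | no j≢m =
  trans (coeff≡coeffℤ N m p) (sym (≡0⇒+-identityˡ (coeffMono-≢ˣ {+ N} {m} {a} {i} j≢m)))

sumBy-++ : ∀ g p r → sumBy g (p ++ r) ≡ sumBy g p + sumBy g r
sumBy-++ g []      r = sym (ℤP.+-identityˡ _)
sumBy-++ g (a ∷ p) r = trans (cong (λ s → g a + s) (sumBy-++ g p r)) (sym (ℤP.+-assoc (g a) _ _))

sumBy-map : ∀ g h p → sumBy g (map h p) ≡ sumBy (λ a → g (h a)) p
sumBy-map g h []      = refl
sumBy-map g h (a ∷ p) = cong (λ s → g (h a) + s) (sumBy-map g h p)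

sumBy-cong : ∀ {g h} p → (∀ a → g a ≡ h a) → sumBy g p ≡ sumBy h p
sumBy-cong []      g≗h = refl
sumBy-cong (a ∷ p) g≗h = cong₂ _+_ (g≗h a) (sumBy-cong p g≗h)

sumBy-zero : ∀ p → sumBy (λ _ → + 0) p ≡ + 0
sumBy-zero []      = refl
sumBy-zero (a ∷ p) = trans (ℤP.+-identityˡ _) (sumBy-zero p)

sumBy-+ : ∀ g h p → sumBy (λ a → g a + h a) p ≡ sumBy g p + sumBy h p
sumBy-+ g h []      = refl
sumBy-+ g h (a ∷ p) =
  trans (cong (λ s → g a + h a + s) (sumBy-+ g h p)) (interchange (g a) (h a) _ _)
  where
  interchange : ∀ a b c d → a + b + (c + d) ≡ a + c + (b + d)
  interchange = solve-∀

sumBy-*ˡ : ∀ c g p → c * sumBy g p ≡ sumBy (λ a → c * g a) p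
sumBy-*ˡ c g []      = ℤP.*-zeroʳ c
sumBy-*ˡ c g (a ∷ p) = trans (ℤP.*-distribˡ-+ c (g a) _) (cong (λ s → c * g a + s) (sumBy-*ˡ c g p))

sumBy-neg : ∀ g p → sumBy (λ a → - g a) p ≡ - sumBy g p
sumBy-neg g []      = refl
sumBy-neg g (a ∷ p) =
  trans (cong (λ s → - g a + s) (sumBy-neg g p)) (sym (ℤP.neg-distrib-+ (g a) _))

sumBy-comm : ∀ (f : Mono → Mono → ℤ) p r →
             sumBy (λ a → sumBy (f a) r) p ≡ sumBy (λ b → sumBy (λ a → f a b) p) r
sumBy-comm f []      r = sym (sumBy-zero r)
sumBy-comm f (a ∷ p) r =
  trans (cong (λ s → sumBy (f a) r + s) (sumBy-comm f p r))
        (sym (sumBy-+ (f a) (λ b → sumBy (λ a → f a b) p) r))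

sumBy-⊗ : ∀ g p r → sumBy g (p ⊗ r) ≡ sumBy (λ a → sumBy (λ b → g (mulM a b)) r) p
sumBy-⊗ g []      r = refl
sumBy-⊗ g (a ∷ p) r =
  trans (sumBy-++ g (map (mulM a) r) (p ⊗ r))
        (cong₂ _+_ (sumBy-map g (mulM a) r) (sumBy-⊗ g p r))

coeffℤ-⊕ : ∀ Q M p r → coeffℤ Q M (p ⊕ r) ≡ coeffℤ Q M p + coeffℤ Q M r
coeffℤ-⊕ Q M = sumBy-++ (coeffMono Q M)

coeffℤ-neg : ∀ Q M p → coeffℤ Q M (neg p) ≡ - coeffℤ Q M p
coeffℤ-neg Q M p =
  trans (sumBy-map (coeffMono Q M) _ p)
        (trans (sumBy-cong p (λ { (mono a i j) → neg-coeffMono a _ _ })) (sumBy-neg (coeffMono Q M) p))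
  where
  neg-coeffMono : ∀ a d e → - a * d * e ≡ - (a * d * e)
  neg-coeffMono = solve-∀

coeffMono-mulM : ∀ Q M a i j b →
                 coeffMono Q M (mulM (mono a i j) b) ≡ a * coeffMono (Q - + i) (M - j) b
coeffMono-mulM Q M a i j (mono c k l) = begin
  a * c * δ (+ (i ℕ.+ k)) Q * δ (j + l) M   ≡⟨ cong₂ (λ u v → a * c * u * v)
                                                  (trans (cong (λ n → δ n Q) (ℤP.pos-+ i k)) (δ-shift (+ i) (+ k) Q))
                                                  (δ-shift j l M) ⟩
  a * c * δ (+ k) (Q - + i) * δ l (M - j)   ≡⟨ reassoc a c _ _ ⟩
  a * (c * δ (+ k) (Q - + i) * δ l (M - j)) ∎
  where
  open ≡-Reasoning
  reassoc : ∀ a c d e → a * c * d * e ≡ a * (c * d * e)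
  reassoc = solve-∀

coeffℤ-⊗-term : ℤ → ℤ → Poly → Mono → ℤ
coeffℤ-⊗-term Q M r (mono a i j) = a * coeffℤ (Q - + i) (M - j) r

coeffℤ-⊗ : ∀ Q M p r → coeffℤ Q M (p ⊗ r) ≡ sumBy (coeffℤ-⊗-term Q M r) p
coeffℤ-⊗ Q M p r = trans (sumBy-⊗ (coeffMono Q M) p r) (sumBy-cong p term)
  where
  term : ∀ a → sumBy (λ b → coeffMono Q M (mulM a b)) r ≡ coeffℤ-⊗-term Q M r a
  term (mono a i j) =
    trans (sumBy-cong r (coeffMono-mulM Q M a i j)) (sym (sumBy-*ˡ a (coeffMono (Q - + i) (M - j)) r))

mono-cong : ∀ {a b i k j l} → a ≡ b → i ≡ k → j ≡ l → mono a i j ≡ mono b k l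
mono-cong refl refl refl = refl

infix 4 _≈_
record _≈_ (p r : Poly) : Set where
  constructor mk≈
  field coeffℤ-≡ : ∀ Q M → coeffℤ Q M p ≡ coeffℤ Q M r
open _≈_ public

≈-refl : ∀ {p} → p ≈ p
≈-refl = mk≈ λ Q M → refl

≈-reflexive : ∀ {p r} → p ≡ r → p ≈ r
≈-reflexive refl = ≈-refl

≈-sym : ∀ {p r} → p ≈ r → r ≈ p
≈-sym p≈r = mk≈ λ Q M → sym (coeffℤ-≡ p≈r Q M)

≈-trans : ∀ {p r s} → p ≈ r → r ≈ s → p ≈ s
≈-trans p≈r r≈s = mk≈ λ Q M → trans (coeffℤ-≡ p≈r Q M) (coeffℤ-≡ r≈s Q M)

⊕-cong : ∀ {p p′ r r′} → p ≈ p′ → r ≈ r′ → p ⊕ r ≈ p′ ⊕ r′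
⊕-cong {p} {p′} {r} {r′} p≈p′ r≈r′ = mk≈ λ Q M → begin
  coeffℤ Q M (p ⊕ r)                ≡⟨ coeffℤ-⊕ Q M p r ⟩
  coeffℤ Q M p + coeffℤ Q M r       ≡⟨ cong₂ _+_ (coeffℤ-≡ p≈p′ Q M) (coeffℤ-≡ r≈r′ Q M) ⟩
  coeffℤ Q M p′ + coeffℤ Q M r′     ≡⟨ coeffℤ-⊕ Q M p′ r′ ⟨
  coeffℤ Q M (p′ ⊕ r′)              ∎
  where open ≡-Reasoning

⊕-congˡ : ∀ p {r r′} → r ≈ r′ → p ⊕ r ≈ p ⊕ r′
⊕-congˡ p = ⊕-cong (≈-refl {p})

neg-cong : ∀ {p r} → p ≈ r → neg p ≈ neg r
neg-cong {p} {r} p≈r = mk≈ λ Q M →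
  trans (coeffℤ-neg Q M p) (trans (cong -_ (coeffℤ-≡ p≈r Q M)) (sym (coeffℤ-neg Q M r)))

⊗-congˡ : ∀ p {r r′} → r ≈ r′ → p ⊗ r ≈ p ⊗ r′
⊗-congˡ p {r} {r′} r≈r′ = mk≈ λ Q M →
  trans (coeffℤ-⊗ Q M p r) (trans (sumBy-cong p (term Q M)) (sym (coeffℤ-⊗ Q M p r′)))
  where
  term : ∀ Q M a → coeffℤ-⊗-term Q M r a ≡ coeffℤ-⊗-term Q M r′ a
  term Q M (mono a i j) = cong (a *_) (coeffℤ-≡ r≈r′ _ _)

⊗-comm : ∀ p r → p ⊗ r ≈ r ⊗ p
⊗-comm p r = mk≈ λ Q M → begin
  coeffℤ Q M (p ⊗ r)                                       ≡⟨ sumBy-⊗ (coeffMono Q M) p r ⟩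
  sumBy (λ a → sumBy (λ b → coeffMono Q M (mulM a b)) r) p ≡⟨ sumBy-comm _ p r ⟩
  sumBy (λ b → sumBy (λ a → coeffMono Q M (mulM a b)) p) r ≡⟨ sumBy-cong r (λ b → sumBy-cong p (λ a →
                                                                cong (coeffMono Q M) (mulM-comm a b))) ⟩
  sumBy (λ b → sumBy (λ a → coeffMono Q M (mulM b a)) p) r ≡⟨ sumBy-⊗ (coeffMono Q M) r p ⟨
  coeffℤ Q M (r ⊗ p)                                       ∎
  where
  open ≡-Reasoning
  mulM-comm : ∀ a b → mulM a b ≡ mulM b a
  mulM-comm (mono a i j) (mono b k l) = mono-cong (ℤP.*-comm a b) (ℕP.+-comm i k) (ℤP.+-comm j l)

⊗-cong : ∀ {p p′ r r′} → p ≈ p′ → r ≈ r′ → p ⊗ r ≈ p′ ⊗ r′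
⊗-cong {p} {p′} {r} {r′} p≈p′ r≈r′ =
  ≈-trans (⊗-congˡ p r≈r′) (≈-trans (⊗-comm p r′) (≈-trans (⊗-congˡ r′ p≈p′) (⊗-comm r′ p′)))

⊗-assoc : ∀ p r s → (p ⊗ r) ⊗ s ≈ p ⊗ (r ⊗ s)
⊗-assoc p r s = mk≈ λ Q M → let g = coeffMono Q M in begin
  coeffℤ Q M ((p ⊗ r) ⊗ s)
    ≡⟨ sumBy-⊗ g (p ⊗ r) s ⟩
  sumBy (λ t → sumBy (λ c → g (mulM t c)) s) (p ⊗ r)
    ≡⟨ sumBy-⊗ (λ t → sumBy (λ c → g (mulM t c)) s) p r ⟩
  sumBy (λ a → sumBy (λ b → sumBy (λ c → g (mulM (mulM a b) c)) s) r) p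
    ≡⟨ sumBy-cong p (λ a → sumBy-cong r (λ b → sumBy-cong s (λ c → cong g (mulM-assoc a b c)))) ⟩
  sumBy (λ a → sumBy (λ b → sumBy (λ c → g (mulM a (mulM b c))) s) r) p
    ≡⟨ sumBy-cong p (λ a → sumBy-⊗ (λ t → g (mulM a t)) r s) ⟨
  sumBy (λ a → sumBy (λ t → g (mulM a t)) (r ⊗ s)) p
    ≡⟨ sumBy-⊗ g p (r ⊗ s) ⟨
  coeffℤ Q M (p ⊗ (r ⊗ s))
    ∎
  where
  open ≡-Reasoning
  mulM-assoc : ∀ a b c → mulM (mulM a b) c ≡ mulM a (mulM b c)
  mulM-assoc (mono a i j) (mono b k l) (mono c m n) =
    mono-cong (ℤP.*-assoc a b c) (ℕP.+-assoc i k m) (ℤP.+-assoc j l n)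

⊗-identityˡ : ∀ p → 1P ⊗ p ≈ p
⊗-identityˡ p = mk≈ λ Q M → begin
  coeffℤ Q M (1P ⊗ p)                        ≡⟨ coeffℤ-⊗ Q M 1P p ⟩
  + 1 * coeffℤ (Q - + 0) (M - + 0) p + + 0   ≡⟨ ℤP.+-identityʳ _ ⟩
  + 1 * coeffℤ (Q - + 0) (M - + 0) p         ≡⟨ ℤP.*-identityˡ _ ⟩
  coeffℤ (Q - + 0) (M - + 0) p               ≡⟨ cong₂ (λ Q M → coeffℤ Q M p) (ℤP.+-identityʳ Q)
                                                                                (ℤP.+-identityʳ M) ⟩
  coeffℤ Q M p                               ∎
  where open ≡-Reasoning

⊗-identityʳ : ∀ p → p ⊗ 1P ≈ p
⊗-identityʳ p = ≈-trans (⊗-comm p 1P) (⊗-identityˡ p)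

⊗-distribˡ-⊕ : ∀ p r s → p ⊗ (r ⊕ s) ≈ p ⊗ r ⊕ p ⊗ s
⊗-distribˡ-⊕ p r s = mk≈ λ Q M → begin
  coeffℤ Q M (p ⊗ (r ⊕ s))
    ≡⟨ coeffℤ-⊗ Q M p (r ⊕ s) ⟩
  sumBy (coeffℤ-⊗-term Q M (r ⊕ s)) p
    ≡⟨ sumBy-cong p (term Q M) ⟩
  sumBy (λ a → coeffℤ-⊗-term Q M r a + coeffℤ-⊗-term Q M s a) p
    ≡⟨ sumBy-+ (coeffℤ-⊗-term Q M r) (coeffℤ-⊗-term Q M s) p ⟩
  sumBy (coeffℤ-⊗-term Q M r) p + sumBy (coeffℤ-⊗-term Q M s) p
    ≡⟨ cong₂ _+_ (coeffℤ-⊗ Q M p r) (coeffℤ-⊗ Q M p s) ⟨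
  coeffℤ Q M (p ⊗ r) + coeffℤ Q M (p ⊗ s)
    ≡⟨ coeffℤ-⊕ Q M (p ⊗ r) (p ⊗ s) ⟨
  coeffℤ Q M (p ⊗ r ⊕ p ⊗ s)
    ∎
  where
  open ≡-Reasoning
  term : ∀ Q M a → coeffℤ-⊗-term Q M (r ⊕ s) a ≡ coeffℤ-⊗-term Q M r a + coeffℤ-⊗-term Q M s a
  term Q M (mono a i j) = trans (cong (a *_) (coeffℤ-⊕ _ _ r s)) (ℤP.*-distribˡ-+ a _ _)

⊗-distribʳ-⊕ : ∀ p r s → (r ⊕ s) ⊗ p ≈ r ⊗ p ⊕ s ⊗ p
⊗-distribʳ-⊕ p r s =
  ≈-trans (⊗-comm (r ⊕ s) p) (≈-trans (⊗-distribˡ-⊕ p r s) (⊕-cong (⊗-comm p r) (⊗-comm p s)))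

⊕-assoc : ∀ p r s → (p ⊕ r) ⊕ s ≈ p ⊕ (r ⊕ s)
⊕-assoc p r s = ≈-reflexive (ListP.++-assoc p r s)

⊕-comm : ∀ p r → p ⊕ r ≈ r ⊕ p
⊕-comm p r = mk≈ λ Q M →
  trans (coeffℤ-⊕ Q M p r) (trans (ℤP.+-comm (coeffℤ Q M p) _) (sym (coeffℤ-⊕ Q M r p)))

⊕-identityʳ : ∀ p → p ⊕ 0P ≈ p
⊕-identityʳ p = ≈-reflexive (ListP.++-identityʳ p)

⊕-inverseˡ : ∀ p → neg p ⊕ p ≈ 0P
⊕-inverseˡ p = mk≈ λ Q M →
  trans (coeffℤ-⊕ Q M (neg p) p) (trans (cong (_+ coeffℤ Q M p) (coeffℤ-neg Q M p)) (ℤP.+-inverseˡ (coeffℤ Q M p)))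

Poly-isCommutativeRing : IsCommutativeRing _≈_ _⊕_ _⊗_ neg 0P 1P
Poly-isCommutativeRing = record
  { isRing = record
    { +-isAbelianGroup = record
      { isGroup = record
        { isMonoid = record
          { isSemigroup = record
            { isMagma = record
              { isEquivalence = record { refl = ≈-refl ; sym = ≈-sym ; trans = ≈-trans }
              ; ∙-cong = ⊕-cong }
            ; assoc = ⊕-assoc }
          ; identity = (λ _ → ≈-refl) , ⊕-identityʳ }
        ; inverse = ⊕-inverseˡ , λ p → ≈-trans (⊕-comm p (neg p)) (⊕-inverseˡ p)
        ; ⁻¹-cong = neg-cong }
      ; comm = ⊕-comm }
    ; *-cong = ⊗-cong
    ; *-assoc = ⊗-assoc
    ; *-identity = ⊗-identityˡ , ⊗-identityʳ
    ; distrib = ⊗-distribˡ-⊕ , ⊗-distribʳ-⊕ }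
  ; *-comm = ⊗-comm }

Poly-commutativeRing : CommutativeRing _ _
Poly-commutativeRing = record { isCommutativeRing = Poly-isCommutativeRing }

module ≈-Reasoning = Relation.Binary.Reasoning.Setoid (CommutativeRing.setoid Poly-commutativeRing)

constant : ℤ → Poly
constant a = mono a 0 (+ 0) ∷ []

coeffℤ-constant : ∀ Q M a → coeffℤ Q M (constant a) ≡ a * (δ (+ 0) Q * δ (+ 0) M)
coeffℤ-constant Q M a = trans (ℤP.+-identityʳ _) (ℤP.*-assoc a _ _)

constant-homomorphism : ℤ.+-*-rawRing ACR.-Raw-AlmostCommutative⟶ ACR.fromCommutativeRing Poly-commutativeRing
constant-homomorphism = record
  { ⟦_⟧    = constant
  ; +-homo = λ a b → mk≈ λ Q M → begin
      coeffℤ Q M (constant (a + b))                 ≡⟨ coeffℤ-constant Q M (a + b) ⟩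
      (a + b) * _                                   ≡⟨ ℤP.*-distribʳ-+ _ a b ⟩
      a * _ + b * _                                 ≡⟨ cong₂ _+_ (coeffℤ-constant Q M a) (coeffℤ-constant Q M b) ⟨
      coeffℤ Q M (constant a) + coeffℤ Q M (constant b) ≡⟨ coeffℤ-⊕ Q M (constant a) (constant b) ⟨
      coeffℤ Q M (constant a ⊕ constant b)          ∎
  ; *-homo = λ _ _ → ≈-refl
  ; -‿homo = λ _ → ≈-refl
  ; 0-homo = mk≈ λ Q M → trans (coeffℤ-constant Q M (+ 0)) (ℤP.*-zeroˡ (δ (+ 0) Q * δ (+ 0) M))
  ; 1-homo = ≈-refl }
  where open ≡-Reasoning

≟-constant : ∀ a b → Maybe (constant a ≈ constant b)
≟-constant a b with a ℤ.≟ b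
... | yes refl = just ≈-refl
... | no  _    = nothing

open RingSolver ℤ.+-*-rawRing (ACR.fromCommutativeRing Poly-commutativeRing) constant-homomorphism ≟-constant
  using (solve; _:=_; _:+_; _:*_; _:-_; con)

⊗-zeroʳ : ∀ p → p ⊗ 0P ≡ 0P
⊗-zeroʳ []      = refl
⊗-zeroʳ (a ∷ p) = ⊗-zeroʳ p

coeffℤ-xpow-⊗ : ∀ Q M j p → coeffℤ Q M (xpow j ⊗ p) ≡ coeffℤ Q (M - j) p
coeffℤ-xpow-⊗ Q M j p = begin
  coeffℤ Q M (xpow j ⊗ p)              ≡⟨ trans (coeffℤ-⊗ Q M (xpow j) p) (ℤP.+-identityʳ _) ⟩
  + 1 * coeffℤ (Q - + 0) (M - j) p     ≡⟨ ℤP.*-identityˡ _ ⟩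
  coeffℤ (Q - + 0) (M - j) p           ≡⟨ cong (λ Q → coeffℤ Q (M - j) p) (ℤP.+-identityʳ Q) ⟩
  coeffℤ Q (M - j) p                   ∎
  where open ≡-Reasoning

NonNegX : Poly → Set
NonNegX = All (λ a → + 0 ℤ.≤ Mono.xe a)

coeffℤ-NonNegX : ∀ {Q M p} → NonNegX p → M ℤ.< + 0 → coeffℤ Q M p ≡ + 0
coeffℤ-NonNegX []                                       M<0 = refl
coeffℤ-NonNegX {Q} {M} {mono a i j ∷ p} (0≤j ∷ nn) M<0 =
  trans (≡0⇒+-identityˡ (coeffMono-≢ˣ {Q} {M} {a} {i} j≢M)) (coeffℤ-NonNegX nn M<0)
  where
  j≢M : j ≢ M
  j≢M refl = ℤP.<⇒≱ M<0 0≤j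

NonNegX-neg : ∀ {p} → NonNegX p → NonNegX (neg p)
NonNegX-neg []        = []
NonNegX-neg (h ∷ nn) = h ∷ NonNegX-neg nn

NonNegX-⊗ : ∀ {p r} → NonNegX p → NonNegX r → NonNegX (p ⊗ r)
NonNegX-⊗ []                 nr = []
NonNegX-⊗ {a ∷ p} {r} (h ∷ np) nr = AllP.++⁺ (AllP.map⁺ (All.map (ℤP.+-mono-≤ h) nr)) (NonNegX-⊗ np nr)

NonNegX-sumR : ∀ n {f} → (∀ i → NonNegX (f i)) → NonNegX (sumR n f)
NonNegX-sumR zero    nf = []
NonNegX-sumR (suc n) nf = AllP.++⁺ (NonNegX-sumR n nf) (nf n)

NonNegX-prodR : ∀ n {f} → (∀ i → NonNegX (f i)) → NonNegX (prodR n f)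
NonNegX-prodR zero    nf = ℤP.≤-refl ∷ []
NonNegX-prodR (suc n) nf = NonNegX-⊗ (NonNegX-prodR n nf) (nf n)

NonNegX-monomial : ∀ a i k → NonNegX (mono a i (+ k) ∷ [])
NonNegX-monomial a i k = ℤ.+≤+ ℕ.z≤n ∷ []

NonNegX-1⊖X⊗qpow : ∀ i → NonNegX (1P ⊖ X ⊗ qpow i)
NonNegX-1⊖X⊗qpow i = AllP.++⁺ (NonNegX-monomial _ 0 0) (NonNegX-neg (NonNegX-monomial _ i 1))

NonNegX-qxP : ∀ n → NonNegX (qxP n)
NonNegX-qxP n = NonNegX-prodR n (λ i → NonNegX-1⊖X⊗qpow (suc i))

NonNegX-gauss : ∀ n c → NonNegX (gauss n c)
NonNegX-gauss n       zero    = NonNegX-monomial _ 0 0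
NonNegX-gauss zero    (suc c) = []
NonNegX-gauss (suc n) (suc c) =
  AllP.++⁺ (NonNegX-gauss n c) (NonNegX-⊗ (NonNegX-monomial (+ 1) (suc c) 0) (NonNegX-gauss n (suc c)))

NonNegX-invQxP : ∀ K c → NonNegX (invQxP K c)
NonNegX-invQxP K c = NonNegX-prodR c (λ i → NonNegX-sumR (suc K) (λ j → NonNegX-monomial _ _ j))

infix 4 _≈[_,_]_
record _≈[_,_]_ (p : Poly) (N M : ℤ) (r : Poly) : Set where
  constructor mk≈[]
  field coeffℤ-≡-below : ∀ {Q L} → Q ℤ.≤ N → L ℤ.≤ M → coeffℤ Q L p ≡ coeffℤ Q L r
open _≈[_,_]_ public

≈⇒≈[] : ∀ {N M p r} → p ≈ r → p ≈[ N , M ] r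
≈⇒≈[] p≈r = mk≈[] λ {Q} {L} _ _ → coeffℤ-≡ p≈r Q L

≈[]-setoid : ℤ → ℤ → Setoid _ _
≈[]-setoid N M = record
  { Carrier       = Poly
  ; _≈_           = _≈[ N , M ]_
  ; isEquivalence = record
    { refl  = mk≈[] λ _ _ → refl
    ; sym   = λ p≈r → mk≈[] λ Q≤N L≤M → sym (coeffℤ-≡-below p≈r Q≤N L≤M)
    ; trans = λ p≈r r≈s → mk≈[] λ Q≤N L≤M →
                trans (coeffℤ-≡-below p≈r Q≤N L≤M) (coeffℤ-≡-below r≈s Q≤N L≤M) } }

module ≈[]-Reasoning (N M : ℤ) = Relation.Binary.Reasoning.Setoid (≈[]-setoid N M)

≈[]-⊕ : ∀ {N M p p′ r r′} → p ≈[ N , M ] p′ → r ≈[ N , M ] r′ → p ⊕ r ≈[ N , M ] p′ ⊕ r′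
≈[]-⊕ {p = p} {p′} {r} {r′} p≈p′ r≈r′ = mk≈[] λ {Q} {L} Q≤N L≤M →
  trans (coeffℤ-⊕ Q L p r)
        (trans (cong₂ _+_ (coeffℤ-≡-below p≈p′ Q≤N L≤M) (coeffℤ-≡-below r≈r′ Q≤N L≤M))
               (sym (coeffℤ-⊕ Q L p′ r′)))

≈[]-⊕-congˡ : ∀ {N M r r′} p → r ≈[ N , M ] r′ → p ⊕ r ≈[ N , M ] p ⊕ r′
≈[]-⊕-congˡ p = ≈[]-⊕ (≈⇒≈[] (≈-refl {p}))

≈[]-⊕-congʳ : ∀ {N M p p′} r → p ≈[ N , M ] p′ → p ⊕ r ≈[ N , M ] p′ ⊕ r
≈[]-⊕-congʳ r p≈p′ = ≈[]-⊕ p≈p′ (≈⇒≈[] (≈-refl {r}))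

≈[]-neg : ∀ {N M p r} → p ≈[ N , M ] r → neg p ≈[ N , M ] neg r
≈[]-neg {p = p} {r} p≈r = mk≈[] λ {Q} {L} Q≤N L≤M →
  trans (coeffℤ-neg Q L p) (trans (cong -_ (coeffℤ-≡-below p≈r Q≤N L≤M)) (sym (coeffℤ-neg Q L r)))

-- Each monomial q^i x^j of s (i, j ≥ 0) reads p at degrees no larger than those read off s ⊗ p.
≈[]-NonNegX-⊗ : ∀ {N M s p r} → NonNegX s → p ≈[ N , M ] r → s ⊗ p ≈[ N , M ] s ⊗ r
≈[]-NonNegX-⊗ {N} {M} {s} {p} {r} ns p≈r = mk≈[] λ {Q} {L} Q≤N L≤M →
  trans (coeffℤ-⊗ Q L s p) (trans (terms Q≤N L≤M ns) (sym (coeffℤ-⊗ Q L s r)))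
  where
  terms : ∀ {Q L s} → Q ℤ.≤ N → L ℤ.≤ M → NonNegX s →
          sumBy (coeffℤ-⊗-term Q L p) s ≡ sumBy (coeffℤ-⊗-term Q L r) s
  terms Q≤N L≤M [] = refl
  terms {Q} {L} {mono c i j ∷ s} Q≤N L≤M (0≤j ∷ ns) = cong₂ _+_
    (cong (c *_) (coeffℤ-≡-below p≈r (ℤP.≤-trans (ℤP.m-n≤m Q i) Q≤N)
                                     (ℤP.≤-trans (ℤP.i-j≤i L j {{ℤ.nonNegative 0≤j}}) L≤M)))
    (terms Q≤N L≤M ns)

≈[]-⊗-NonNegX : ∀ {N M s p r} → NonNegX s → p ≈[ N , M ] r → p ⊗ s ≈[ N , M ] r ⊗ s
≈[]-⊗-NonNegX {N} {M} {s} {p} {r} ns p≈r = begin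
  p ⊗ s ≈⟨ ≈⇒≈[] (⊗-comm p s) ⟩
  s ⊗ p ≈⟨ ≈[]-NonNegX-⊗ ns p≈r ⟩
  s ⊗ r ≈⟨ ≈⇒≈[] (⊗-comm s r) ⟩
  r ⊗ s ∎
  where open ≈[]-Reasoning N M

X⊗-≈[] : ∀ {N M p r} → p ≈[ N , M - + 1 ] r → X ⊗ p ≈[ N , M ] X ⊗ r
X⊗-≈[] {p = p} {r} p≈r = mk≈[] λ {Q} {L} Q≤N L≤M →
  trans (coeffℤ-xpow-⊗ Q L (+ 1) p)
        (trans (coeffℤ-≡-below p≈r Q≤N (ℤP.+-monoˡ-≤ (- + 1) L≤M)) (sym (coeffℤ-xpow-⊗ Q L (+ 1) r)))

xpow-⊗-≈[]-0 : ∀ {N M g} d → NonNegX g → M ℤ.< d → xpow d ⊗ g ≈[ N , M ] 0P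
xpow-⊗-≈[]-0 {g = g} d ng M<d = mk≈[] λ {Q} {L} _ L≤M →
  trans (coeffℤ-xpow-⊗ Q L d g) (coeffℤ-NonNegX ng (L-d<0 L≤M))
  where
  L-d<0 : ∀ {L} → L ℤ.≤ _ → L - d ℤ.< + 0
  L-d<0 {L} L≤M =
    ℤP.<-≤-trans (ℤP.+-monoˡ-< (- d) (ℤP.≤-<-trans L≤M M<d)) (ℤP.≤-reflexive (ℤP.+-inverseʳ d))

xpow-≈[]-0 : ∀ {N M} d → M ℤ.< d → xpow d ≈[ N , M ] 0P
xpow-≈[]-0 {N} {M} d M<d = begin
  xpow d      ≈⟨ ≈⇒≈[] (≈-sym (⊗-identityʳ (xpow d))) ⟩
  xpow d ⊗ 1P ≈⟨ xpow-⊗-≈[]-0 d (NonNegX-monomial (+ 1) 0 0) M<d ⟩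
  0P          ∎
  where open ≈[]-Reasoning N M

monomial-≈[]-0 : ∀ {N M} a i j → N ℤ.< + i → mono a i j ∷ [] ≈[ N , M ] 0P
monomial-≈[]-0 {N} a i j N<i = mk≈[] λ {Q} {L} Q≤N _ →
  trans (ℤP.+-identityʳ _) (coeffMono-≢ᵠ {Q} {L} {a} {i} {j} (λ { refl → ℤP.<⇒≱ N<i Q≤N }))

sumR-cong : ∀ n {f g} → (∀ i → i ℕ.< n → f i ≈ g i) → sumR n f ≈ sumR n g
sumR-cong zero    f≈g = ≈-refl
sumR-cong (suc n) f≈g = ⊕-cong (sumR-cong n (λ i i<n → f≈g i (ℕP.m<n⇒m<1+n i<n))) (f≈g n ℕP.≤-refl)

sumR-cong-≈[] : ∀ {N M} n {f g} → (∀ i → f i ≈[ N , M ] g i) → sumR n f ≈[ N , M ] sumR n g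
sumR-cong-≈[] zero    f≈g = ≈⇒≈[] ≈-refl
sumR-cong-≈[] (suc n) f≈g = ≈[]-⊕ (sumR-cong-≈[] n f≈g) (f≈g n)

sumR-zero : ∀ n → sumR n (λ _ → 0P) ≈ 0P
sumR-zero zero    = ≈-refl
sumR-zero (suc n) = ≈-trans (⊕-identityʳ _) (sumR-zero n)

sumR-⊕ : ∀ n f g → sumR n (λ i → f i ⊕ g i) ≈ sumR n f ⊕ sumR n g
sumR-⊕ zero    f g = ≈-refl
sumR-⊕ (suc n) f g = ≈-trans (⊕-cong (sumR-⊕ n f g) ≈-refl)
  (solve 4 (λ F G f g → (F :+ G) :+ (f :+ g) := (F :+ f) :+ (G :+ g)) ≈-refl (sumR n f) (sumR n g) (f n) (g n))

sumR-⊗ : ∀ n a f → sumR n (λ i → a ⊗ f i) ≈ a ⊗ sumR n f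
sumR-⊗ zero    a f = ≈-reflexive (sym (⊗-zeroʳ a))
sumR-⊗ (suc n) a f = ≈-trans (⊕-cong (sumR-⊗ n a f) ≈-refl) (≈-sym (⊗-distribˡ-⊕ a (sumR n f) (f n)))

sumR-linear : ∀ n a b f g → sumR n (λ i → a ⊗ f i ⊕ b ⊗ g i) ≈ a ⊗ sumR n f ⊕ b ⊗ sumR n g
sumR-linear n a b f g = ≈-trans (sumR-⊕ n _ _) (⊕-cong (sumR-⊗ n a f) (sumR-⊗ n b g))

sumR-suc : ∀ n f → sumR (suc n) f ≈ f 0 ⊕ sumR n (λ i → f (suc i))
sumR-suc zero    f = ≈-sym (⊕-identityʳ (f 0))
sumR-suc (suc n) f = ≈-trans (⊕-cong (sumR-suc n f) ≈-refl) (⊕-assoc (f 0) _ _)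

sumR-comm : ∀ n m (f : ℕ → ℕ → Poly) → sumR n (λ i → sumR m (f i)) ≈ sumR m (λ j → sumR n (λ i → f i j))
sumR-comm zero    m f = ≈-sym (sumR-zero m)
sumR-comm (suc n) m f =
  ≈-trans (⊕-cong (sumR-comm n m f) ≈-refl) (≈-sym (sumR-⊕ m (λ j → sumR n (λ i → f i j)) (f n)))

sumR-vanishing : ∀ {n m} f → n ℕ.≤ m → (∀ i → n ℕ.≤ i → f i ≈ 0P) → sumR m f ≈ sumR n f
sumR-vanishing {n} {m} f n≤m f≈0 = go (ℕP.≤⇒≤′ n≤m)
  where
  go : ∀ {m} → n ℕ.≤′ m → sumR m f ≈ sumR n f
  go ℕ.≤′-refl                = ≈-refl
  go (ℕ.≤′-step {m} n≤′m) = ≈-trans (⊕-cong (go n≤′m) (f≈0 m (ℕP.≤′⇒≤ n≤′m))) (⊕-identityʳ _)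

sumR-telescope : ∀ n t u → (∀ j → t (suc j) ≈ t j ⊗ u) → sumR (suc n) t ⊗ (1P ⊖ u) ≈ t 0 ⊖ t (suc n)
sumR-telescope zero    t u t-step =
  ≈-trans (solve 2 (λ t u → t :* (con (+ 1) :- u) := t :- t :* u) ≈-refl (t 0) u)
          (⊕-congˡ (t 0) (neg-cong (≈-sym (t-step 0))))
sumR-telescope (suc n) t u t-step =
  ≈-trans (solve 3 (λ S t u → (S :+ t) :* (con (+ 1) :- u) := S :* (con (+ 1) :- u) :+ (t :- t :* u)) ≈-refl
                   (sumR (suc n) t) (t (suc n)) u)
  (≈-trans (⊕-cong (sumR-telescope n t u t-step) (⊕-congˡ (t (suc n)) (neg-cong (≈-sym (t-step (suc n))))))
           (solve 3 (λ a b c → (a :- b) :+ (b :- c) := a :- c) ≈-refl (t 0) (t (suc n)) (t (suc (suc n)))))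

1⊖X : Poly
1⊖X = 1P ⊖ X

NonNegX-1⊖X : NonNegX 1⊖X
NonNegX-1⊖X = NonNegX-1⊖X⊗qpow 0

qxP-suc : ∀ n → qxP (suc n) ≡ qxP n ⊗ (1P ⊖ X ⊗ qpow (suc n))
qxP-suc n = refl

xP-suc : ∀ n → xP (suc n) ≈ 1⊖X ⊗ qxP n
xP-suc zero    = solve 1 (λ x → con (+ 1) :* (con (+ 1) :- x) := (con (+ 1) :- x) :* con (+ 1)) ≈-refl X
xP-suc (suc n) = ≈-trans (⊗-cong (xP-suc n) ≈-refl) (⊗-assoc 1⊖X (qxP n) _)

geomTerm : ℕ → ℕ → Poly
geomTerm i j = mono (+ 1) (suc i ℕ.* j) (+ j) ∷ []

invQxP-suc : ∀ K c → invQxP K (suc c) ≡ invQxP K c ⊗ sumR (suc K) (geomTerm c)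
invQxP-suc K c = refl

geomTerm-suc : ∀ i j → geomTerm i (suc j) ≈ geomTerm i j ⊗ (X ⊗ qpow (suc i))
geomTerm-suc i j = ≈-reflexive (cong (_∷ []) (mono-cong refl
  (trans (ℕP.*-suc (suc i) j) (ℕP.+-comm (suc i) _))
  (trans (cong +_ (ℕP.+-comm 1 j)) (ℤP.pos-+ j 1))))

geomSum-⊗-≈[] : ∀ {N M} K i → N ℤ.≤ + K →
                sumR (suc K) (geomTerm i) ⊗ (1P ⊖ X ⊗ qpow (suc i)) ≈[ N , M ] 1P
geomSum-⊗-≈[] {N} {M} K i N≤K = begin
  sumR (suc K) (geomTerm i) ⊗ (1P ⊖ X ⊗ qpow (suc i))
    ≈⟨ ≈⇒≈[] (sumR-telescope K (geomTerm i) _ (geomTerm-suc i)) ⟩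
  geomTerm i 0 ⊖ geomTerm i (suc K)
    ≈⟨ ≈[]-⊕ (≈⇒≈[] first) (≈[]-neg (monomial-≈[]-0 _ _ _ N<top)) ⟩
  1P ⊕ neg 0P
    ≈⟨ ≈⇒≈[] (⊕-identityʳ 1P) ⟩
  1P
    ∎
  where
  open ≈[]-Reasoning N M
  first : geomTerm i 0 ≈ 1P
  first = ≈-reflexive (cong (λ e → mono (+ 1) e (+ 0) ∷ []) (ℕP.*-zeroʳ (suc i)))
  N<top : N ℤ.< + (suc i ℕ.* suc K)
  N<top = ℤP.≤-<-trans N≤K (ℤ.+<+ (ℕP.<-≤-trans (ℕP.n<1+n K) (ℕP.m≤n*m (suc K) (suc i))))

invQxP-⊗-qxP : ∀ {N M} K c → N ℤ.≤ + K → invQxP K c ⊗ qxP c ≈[ N , M ] 1P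
invQxP-⊗-qxP K zero    N≤K = ≈⇒≈[] (⊗-identityˡ 1P)
invQxP-⊗-qxP {N} {M} K (suc c) N≤K = begin
  invQxP K (suc c) ⊗ qxP (suc c)
    ≡⟨ cong₂ _⊗_ (invQxP-suc K c) (qxP-suc c) ⟩
  (invQxP K c ⊗ G) ⊗ (qxP c ⊗ F)
    ≈⟨ ≈⇒≈[] (solve 4 (λ a g p f → (a :* g) :* (p :* f) := (a :* p) :* (g :* f)) ≈-refl (invQxP K c) G (qxP c) F) ⟩
  (invQxP K c ⊗ qxP c) ⊗ (G ⊗ F)
    ≈⟨ ≈[]-NonNegX-⊗ (NonNegX-⊗ (NonNegX-invQxP K c) (NonNegX-qxP c)) (geomSum-⊗-≈[] K c N≤K) ⟩
  (invQxP K c ⊗ qxP c) ⊗ 1P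
    ≈⟨ ≈⇒≈[] (⊗-identityʳ _) ⟩
  invQxP K c ⊗ qxP c
    ≈⟨ invQxP-⊗-qxP K c N≤K ⟩
  1P
    ∎
  where
  open ≈[]-Reasoning N M
  G = sumR (suc K) (geomTerm c)
  F = 1P ⊖ X ⊗ qpow (suc c)

gaussSeries : ℕ → ℕ → Poly
gaussSeries c L = sumR (suc L) (λ n → xpow (+ n) ⊗ gauss n c)

NonNegX-gaussSeries : ∀ c L → NonNegX (gaussSeries c L)
NonNegX-gaussSeries c L = NonNegX-sumR (suc L) (λ n → NonNegX-⊗ (NonNegX-monomial (+ 1) 0 n) (NonNegX-gauss n c))

gaussSeries-suc : ∀ c L →
  gaussSeries (suc c) (suc L) ≈ X ⊗ gaussSeries c L ⊕ X ⊗ (qpow (suc c) ⊗ gaussSeries (suc c) L)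
gaussSeries-suc c L = begin
  gaussSeries (suc c) (suc L)
    ≈⟨ sumR-suc (suc L) (λ n → xpow (+ n) ⊗ gauss n (suc c)) ⟩
  sumR (suc L) (λ n → xpow (+ suc n) ⊗ (gauss n c ⊕ qpow (suc c) ⊗ gauss n (suc c)))
    ≈⟨ sumR-cong (suc L) (λ n _ → qPascal (xpow (+ n)) (gauss n c) (gauss n (suc c))) ⟩
  sumR (suc L) (λ n → X ⊗ (xpow (+ n) ⊗ gauss n c) ⊕ (X ⊗ qpow (suc c)) ⊗ (xpow (+ n) ⊗ gauss n (suc c)))
    ≈⟨ sumR-linear (suc L) X (X ⊗ qpow (suc c)) _ _ ⟩
  X ⊗ gaussSeries c L ⊕ (X ⊗ qpow (suc c)) ⊗ gaussSeries (suc c) L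
    ≈⟨ ⊕-congˡ (X ⊗ gaussSeries c L) (⊗-assoc X (qpow (suc c)) (gaussSeries (suc c) L)) ⟩
  X ⊗ gaussSeries c L ⊕ X ⊗ (qpow (suc c) ⊗ gaussSeries (suc c) L)
    ∎
  where
  open ≈-Reasoning
  qPascal : ∀ y g g′ → (X ⊗ y) ⊗ (g ⊕ qpow (suc c) ⊗ g′)
                      ≈ X ⊗ (y ⊗ g) ⊕ (X ⊗ qpow (suc c)) ⊗ (y ⊗ g′)
  qPascal = solve 5 (λ x q y g g′ → (x :* y) :* (g :+ q :* g′) := x :* (y :* g) :+ (x :* q) :* (y :* g′))
                    ≈-refl X (qpow (suc c))

gaussSeries-≈[]-suc : ∀ {N M} c L → M ℤ.≤ + L → gaussSeries c L ≈[ N , M ] gaussSeries c (suc L)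
gaussSeries-≈[]-suc {N} {M} c L M≤L = begin
  gaussSeries c L       ≈⟨ ≈⇒≈[] (≈-sym (⊕-identityʳ _)) ⟩
  gaussSeries c L ⊕ 0P  ≈⟨ ≈[]-⊕-congˡ (gaussSeries c L) top≈0 ⟨
  gaussSeries c (suc L) ∎
  where
  open ≈[]-Reasoning N M
  top≈0 : xpow (+ suc L) ⊗ gauss (suc L) c ≈[ N , M ] 0P
  top≈0 = xpow-⊗-≈[]-0 (+ suc L) (NonNegX-gauss (suc L) c) (ℤP.≤-<-trans M≤L (ℤ.+<+ (ℕP.n<1+n L)))

i≤1+n⇒i-1≤n : ∀ {i n} → i ℤ.≤ + suc n → i - + 1 ℤ.≤ + n
i≤1+n⇒i-1≤n {i} {n} i≤1+n =
  ℤP.≤-trans (ℤP.+-monoˡ-≤ (- + 1) i≤1+n) (ℤP.≤-reflexive (ℤP.[+m]-[+n]≡m⊖n (suc n) 1))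

gaussSeries-recurrence : ∀ {N M} c L → M ℤ.≤ + suc L →
  gaussSeries (suc c) (suc L) ⊖ X ⊗ (qpow (suc c) ⊗ gaussSeries (suc c) (suc L)) ≈[ N , M ] X ⊗ gaussSeries c L
gaussSeries-recurrence {N} {M} c L M≤1+L = begin
  S ⊖ X ⊗ (q ⊗ S)
    ≈⟨ ≈[]-⊕-congʳ (neg (X ⊗ (q ⊗ S))) (≈⇒≈[] (gaussSeries-suc c L)) ⟩
  X ⊗ gaussSeries c L ⊕ X ⊗ (q ⊗ S′) ⊖ X ⊗ (q ⊗ S)
    ≈⟨ ≈[]-⊕-congʳ (neg (X ⊗ (q ⊗ S))) (≈[]-⊕-congˡ (X ⊗ gaussSeries c L) S′≈S) ⟩
  X ⊗ gaussSeries c L ⊕ X ⊗ (q ⊗ S) ⊖ X ⊗ (q ⊗ S)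
    ≈⟨ ≈⇒≈[] (solve 2 (λ a b → a :+ b :- b := a) ≈-refl (X ⊗ gaussSeries c L) (X ⊗ (q ⊗ S))) ⟩
  X ⊗ gaussSeries c L
    ∎
  where
  open ≈[]-Reasoning N M
  q = qpow (suc c)
  S = gaussSeries (suc c) (suc L)
  S′ = gaussSeries (suc c) L
  S′≈S : X ⊗ (q ⊗ S′) ≈[ N , M ] X ⊗ (q ⊗ S)
  S′≈S = X⊗-≈[] (≈[]-NonNegX-⊗ (NonNegX-monomial (+ 1) (suc c) 0)
                                (gaussSeries-≈[]-suc (suc c) L (i≤1+n⇒i-1≤n M≤1+L)))

gaussSeries-closedForm : ∀ {N M} c L → M ℤ.≤ + L → 1⊖X ⊗ qxP c ⊗ gaussSeries c L ≈[ N , M ] xpow (+ c)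
gaussSeries-closedForm {N} {M} zero L M≤L = begin
  1⊖X ⊗ 1P ⊗ gaussSeries 0 L
    ≈⟨ ≈⇒≈[] (solve 2 (λ x F → (con (+ 1) :- x) :* con (+ 1) :* F := F :* (con (+ 1) :- x))
                      ≈-refl X (gaussSeries 0 L)) ⟩
  gaussSeries 0 L ⊗ (1P ⊖ X)
    ≈⟨ ≈⇒≈[] (sumR-telescope L t X t-suc) ⟩
  t 0 ⊖ t (suc L)
    ≈⟨ ≈[]-⊕ (≈⇒≈[] (⊗-identityʳ 1P)) (≈[]-neg top≈0) ⟩
  1P ⊖ 0P
    ≈⟨ ≈⇒≈[] (⊕-identityʳ 1P) ⟩
  1P
    ∎
  where
  open ≈[]-Reasoning N M
  t : ℕ → Poly
  t n = xpow (+ n) ⊗ 1P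
  t-suc : ∀ j → t (suc j) ≈ t j ⊗ X
  t-suc j = solve 2 (λ x y → (x :* y) :* con (+ 1) := (y :* con (+ 1)) :* x) ≈-refl X (xpow (+ j))
  top≈0 : t (suc L) ≈[ N , M ] 0P
  top≈0 = xpow-⊗-≈[]-0 (+ suc L) (NonNegX-monomial (+ 1) 0 0) (ℤP.≤-<-trans M≤L (ℤ.+<+ (ℕP.n<1+n L)))
gaussSeries-closedForm {N} {M} (suc c) zero M≤0 = begin
  1⊖X ⊗ qxP (suc c) ⊗ 0P         ≡⟨ ⊗-zeroʳ (1⊖X ⊗ qxP (suc c)) ⟩
  0P                             ≈⟨ xpow-≈[]-0 (+ suc c) (ℤP.≤-<-trans M≤0 (ℤ.+<+ ℕ.z<s)) ⟨
  xpow (+ suc c)                 ∎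
  where open ≈[]-Reasoning N M
gaussSeries-closedForm {N} {M} (suc c) (suc L) M≤1+L = begin
  1⊖X ⊗ qxP (suc c) ⊗ S
    ≡⟨ cong (λ P → 1⊖X ⊗ P ⊗ S) (qxP-suc c) ⟩
  1⊖X ⊗ (qxP c ⊗ (1P ⊖ X ⊗ q)) ⊗ S
    ≈⟨ ≈⇒≈[] (solve 5 (λ a P x q S → a :* (P :* (con (+ 1) :- x :* q)) :* S := (a :* P) :* (S :- x :* (q :* S)))
                       ≈-refl 1⊖X (qxP c) X q S) ⟩
  (1⊖X ⊗ qxP c) ⊗ (S ⊖ X ⊗ (q ⊗ S))
    ≈⟨ ≈[]-NonNegX-⊗ (NonNegX-⊗ NonNegX-1⊖X (NonNegX-qxP c)) (gaussSeries-recurrence c L M≤1+L) ⟩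
  (1⊖X ⊗ qxP c) ⊗ (X ⊗ gaussSeries c L)
    ≈⟨ ≈⇒≈[] (solve 3 (λ a x F → a :* (x :* F) := x :* (a :* F))
                      ≈-refl (1⊖X ⊗ qxP c) X (gaussSeries c L)) ⟩
  X ⊗ (1⊖X ⊗ qxP c ⊗ gaussSeries c L)
    ≈⟨ X⊗-≈[] (gaussSeries-closedForm c L (i≤1+n⇒i-1≤n M≤1+L)) ⟩
  xpow (+ suc c)
    ∎
  where
  open ≈[]-Reasoning N M
  q = qpow (suc c)
  S = gaussSeries (suc c) (suc L)

1⊖X⊗gaussSeries : ∀ {N M} c L K → M ℤ.≤ + L → N ℤ.≤ + K →
                  1⊖X ⊗ gaussSeries c L ≈[ N , M ] xpow (+ c) ⊗ invQxP K c
1⊖X⊗gaussSeries {N} {M} c L K M≤L N≤K = begin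
  1⊖X ⊗ F
    ≈⟨ ≈⇒≈[] (⊗-identityʳ (1⊖X ⊗ F)) ⟨
  (1⊖X ⊗ F) ⊗ 1P
    ≈⟨ ≈[]-NonNegX-⊗ (NonNegX-⊗ NonNegX-1⊖X (NonNegX-gaussSeries c L)) (invQxP-⊗-qxP K c N≤K) ⟨
  (1⊖X ⊗ F) ⊗ (invQxP K c ⊗ qxP c)
    ≈⟨ ≈⇒≈[] (solve 4 (λ a F i P → (a :* F) :* (i :* P) := (a :* P :* F) :* i) ≈-refl 1⊖X F (invQxP K c) (qxP c)) ⟩
  (1⊖X ⊗ qxP c ⊗ F) ⊗ invQxP K c
    ≈⟨ ≈[]-⊗-NonNegX (NonNegX-invQxP K c) (gaussSeries-closedForm c L M≤L) ⟩
  xpow (+ c) ⊗ invQxP K c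
    ∎
  where
  open ≈[]-Reasoning N M
  F = gaussSeries c L

gauss-vanishing : ∀ {n c} → n ℕ.< c → gauss n c ≡ 0P
gauss-vanishing {zero}  {suc c} _ = refl
gauss-vanishing {suc n} {suc c} (ℕ.s≤s n<c)
  rewrite gauss-vanishing n<c | gauss-vanishing (ℕP.m<n⇒m<1+n n<c) = refl

weight : ℕ → Poly
weight c = qpow (c ℕ.* c) ⊗ xpow (+ (2 ℕ.* c))

NonNegX-weight : ∀ c → NonNegX (weight c)
NonNegX-weight c = NonNegX-⊗ (NonNegX-monomial (+ 1) _ 0) (NonNegX-monomial (+ 1) 0 (2 ℕ.* c))

weightedTerm : ℕ → ℕ → Poly
weightedTerm n c = weight c ⊗ (xpow (+ n) ⊗ gauss n c)

weightedTerm-vanishing : ∀ {n c} → n ℕ.< c → weightedTerm n c ≈ 0P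
weightedTerm-vanishing {n} {c} n<c
  rewrite gauss-vanishing n<c | ⊗-zeroʳ (xpow (+ n)) = ≈-reflexive (⊗-zeroʳ (weight c))

X⊗core : ∀ k c → X ⊗ core k c ≈ weightedTerm (suc k) c
X⊗core k c = solve 5 (λ x y q z g → x :* (y :* q :* z :* g) := (q :* z) :* ((x :* y) :* g)) ≈-refl
                     X (xpow (+ k)) (qpow (c ℕ.* c)) (xpow (+ (2 ℕ.* c))) (gauss (suc k) c)

coreSum : ℕ → Poly
coreSum K = sumR K (λ k → sumR (suc (suc k)) (core k))

-- 1 is the n = 0 term; then exchange the order of summation.
1⊕X⊗coreSum : ∀ K → 1P ⊕ X ⊗ coreSum K ≈ sumR (suc K) (λ c → weight c ⊗ gaussSeries c K)
1⊕X⊗coreSum K = begin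
  1P ⊕ X ⊗ coreSum K
    ≈⟨ ⊕-cong (≈-sym row₀≈1) X⊗coreSum ⟩
  row 0 ⊕ sumR K (λ k → row (suc k))
    ≈⟨ sumR-suc K row ⟨
  sumR (suc K) row
    ≈⟨ sumR-comm (suc K) (suc K) weightedTerm ⟩
  sumR (suc K) (λ c → sumR (suc K) (λ n → weight c ⊗ (xpow (+ n) ⊗ gauss n c)))
    ≈⟨ sumR-cong (suc K) (λ c _ → sumR-⊗ (suc K) (weight c) _) ⟩
  sumR (suc K) (λ c → weight c ⊗ gaussSeries c K)
    ∎
  where
  open ≈-Reasoning
  row : ℕ → Poly
  row n = sumR (suc K) (weightedTerm n)
  row₀≈1 : row 0 ≈ 1P
  row₀≈1 = begin
    row 0                                                ≈⟨ sumR-suc K (weightedTerm 0) ⟩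
    weightedTerm 0 0 ⊕ sumR K (λ c → weightedTerm 0 (suc c))
      ≈⟨ ⊕-congˡ (weightedTerm 0 0) (sumR-cong K (λ c _ → weightedTerm-vanishing {0} {suc c} ℕ.z<s)) ⟩
    weightedTerm 0 0 ⊕ sumR K (λ _ → 0P)                 ≈⟨ ⊕-congˡ (weightedTerm 0 0) (sumR-zero K) ⟩
    weightedTerm 0 0 ⊕ 0P                                ≈⟨ ⊕-identityʳ _ ⟩
    1P                                                   ∎
  X⊗coreSum : X ⊗ coreSum K ≈ sumR K (λ k → row (suc k))
  X⊗coreSum = begin
    X ⊗ coreSum K                                    ≈⟨ sumR-⊗ K X _ ⟨
    sumR K (λ k → X ⊗ sumR (suc (suc k)) (core k))   ≈⟨ sumR-cong K X⊗inner ⟩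
    sumR K (λ k → row (suc k))                       ∎
    where
    X⊗inner : ∀ k → k ℕ.< K → X ⊗ sumR (suc (suc k)) (core k) ≈ row (suc k)
    X⊗inner k k<K = begin
      X ⊗ sumR (suc (suc k)) (core k)             ≈⟨ sumR-⊗ (suc (suc k)) X (core k) ⟨
      sumR (suc (suc k)) (λ c → X ⊗ core k c)     ≈⟨ sumR-cong (suc (suc k)) (λ c _ → X⊗core k c) ⟩
      sumR (suc (suc k)) (weightedTerm (suc k))   ≈⟨ sumR-vanishing (weightedTerm (suc k)) (ℕ.s≤s k<K)
                                                                    (λ c → weightedTerm-vanishing {suc k} {c}) ⟨
      row (suc k)                                 ∎

invSum : ℕ → Poly
invSum K = sumR (suc K) (λ c → qpow (c ℕ.* c) ⊗ invQxP K c ⊗ xpow ((+ (3 ℕ.* c)) - + 1))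

X⊗invSum : ∀ K → X ⊗ invSum K ≈ sumR (suc K) (λ c → weight c ⊗ (xpow (+ c) ⊗ invQxP K c))
X⊗invSum K = ≈-trans (≈-sym (sumR-⊗ (suc K) X _)) (sumR-cong (suc K) (λ c _ → term c))
  where
  x-exponent : ∀ c → + 1 + (+ (3 ℕ.* c) - + 1) ≡ + (2 ℕ.* c) + + c
  x-exponent c = begin
    + 1 + (+ (3 ℕ.* c) - + 1) ≡⟨ cong (λ z → + 1 + (z - + 1)) (ℤP.pos-* 3 c) ⟩
    + 1 + (+ 3 * + c - + 1)   ≡⟨ arith (+ c) ⟩
    + 2 * + c + + c           ≡⟨ cong (_+ + c) (ℤP.pos-* 2 c) ⟨
    + (2 ℕ.* c) + + c         ∎
    where
    open ≡-Reasoning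
    arith : ∀ z → + 1 + (+ 3 * z - + 1) ≡ + 2 * z + z
    arith = solve-∀
  term : ∀ c → X ⊗ (qpow (c ℕ.* c) ⊗ invQxP K c ⊗ xpow (+ (3 ℕ.* c) - + 1))
                 ≈ weight c ⊗ (xpow (+ c) ⊗ invQxP K c)
  term c = begin
    X ⊗ (qpow (c ℕ.* c) ⊗ invQxP K c ⊗ xpow (+ (3 ℕ.* c) - + 1))
      ≈⟨ solve 4 (λ x q i y → x :* (q :* i :* y) := (q :* (x :* y)) :* i) ≈-refl
                 X (qpow (c ℕ.* c)) (invQxP K c) (xpow (+ (3 ℕ.* c) - + 1)) ⟩
    (qpow (c ℕ.* c) ⊗ (X ⊗ xpow (+ (3 ℕ.* c) - + 1))) ⊗ invQxP K c
      ≡⟨ cong (λ e → (qpow (c ℕ.* c) ⊗ (mono (+ 1) 0 e ∷ [])) ⊗ invQxP K c) (x-exponent c) ⟩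
    (qpow (c ℕ.* c) ⊗ (xpow (+ (2 ℕ.* c)) ⊗ xpow (+ c))) ⊗ invQxP K c
      ≈⟨ solve 4 (λ q a b i → (q :* (a :* b)) :* i := (q :* a) :* (b :* i)) ≈-refl
                 (qpow (c ℕ.* c)) (xpow (+ (2 ℕ.* c))) (xpow (+ c)) (invQxP K c) ⟩
    weight c ⊗ (xpow (+ c) ⊗ invQxP K c)
      ∎
    where open ≈-Reasoning

1⊖X⊗[1⊕X⊗coreSum] : ∀ {N M} K → M ℤ.≤ + K → N ℤ.≤ + K →
                     1⊖X ⊗ (1P ⊕ X ⊗ coreSum K) ≈[ N , M ] X ⊗ invSum K
1⊖X⊗[1⊕X⊗coreSum] {N} {M} K M≤K N≤K = begin
  1⊖X ⊗ (1P ⊕ X ⊗ coreSum K)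
    ≈⟨ ≈⇒≈[] (⊗-congˡ 1⊖X (1⊕X⊗coreSum K)) ⟩
  1⊖X ⊗ sumR (suc K) (λ c → weight c ⊗ gaussSeries c K)
    ≈⟨ ≈⇒≈[] (≈-sym (sumR-⊗ (suc K) 1⊖X _)) ⟩
  sumR (suc K) (λ c → 1⊖X ⊗ (weight c ⊗ gaussSeries c K))
    ≈⟨ ≈⇒≈[] (sumR-cong (suc K) (λ c _ → solve 3 (λ a w F → a :* (w :* F) := w :* (a :* F))
                                                  ≈-refl 1⊖X (weight c) (gaussSeries c K))) ⟩
  sumR (suc K) (λ c → weight c ⊗ (1⊖X ⊗ gaussSeries c K))
    ≈⟨ sumR-cong-≈[] (suc K) (λ c → ≈[]-NonNegX-⊗ (NonNegX-weight c) (1⊖X⊗gaussSeries c K K M≤K N≤K)) ⟩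
  sumR (suc K) (λ c → weight c ⊗ (xpow (+ c) ⊗ invQxP K c))
    ≈⟨ ≈⇒≈[] (X⊗invSum K) ⟨
  X ⊗ invSum K
    ∎
  where open ≈[]-Reasoning N M

correctionTerm : ℕ → Poly
correctionTerm K = 1⊖X ⊗ sumR K (λ k → sumR (suc (suc k)) (λ c → (qxP k ⊖ qxP K) ⊗ core k c))

Gtrunc-split : ∀ K → Gtrunc K ≈ correctionTerm K ⊕ 1⊖X ⊗ qxP K ⊗ coreSum K
Gtrunc-split K =
  ≈-trans (sumR-cong K λ k _ →
             ≈-trans (sumR-cong (suc (suc k)) (λ c _ → split k c))
                     (sumR-linear (suc (suc k)) 1⊖X (1⊖X ⊗ qxP K) _ (core k)))
          (sumR-linear K 1⊖X (1⊖X ⊗ qxP K) _ _)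
  where
  split : ∀ k c → xP (suc k) ⊗ core k c ≈ 1⊖X ⊗ ((qxP k ⊖ qxP K) ⊗ core k c) ⊕ (1⊖X ⊗ qxP K) ⊗ core k c
  split k c = ≈-trans (⊗-cong (xP-suc k) ≈-refl)
    (solve 4 (λ a p P r → a :* p :* r := a :* ((p :- P) :* r) :+ (a :* P) :* r)
             ≈-refl 1⊖X (qxP k) (qxP K) (core k c))

X⊗xpow-1 : X ⊗ xpow -[1+ 0 ] ≡ 1P
X⊗xpow-1 = refl

X⊗Gtrunc≈X⊗RHStrunc : ∀ {N M} K → M ℤ.≤ + K → N ℤ.≤ + K →
                       X ⊗ Gtrunc K ≈[ N , M ] X ⊗ RHStrunc K
X⊗Gtrunc≈X⊗RHStrunc {N} {M} K M≤K N≤K = begin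
  X ⊗ Gtrunc K
    ≈⟨ ≈⇒≈[] (⊗-congˡ X (Gtrunc-split K)) ⟩
  X ⊗ (C ⊕ 1⊖X ⊗ P ⊗ coreSum K)
    ≈⟨ ≈⇒≈[] (solve 4 (λ x C P A → x :* (C :+ (con (+ 1) :- x) :* P :* A)
                         := x :* C :+ (P :* ((con (+ 1) :- x) :* (con (+ 1) :+ x :* A)) :- (con (+ 1) :- x) :* P))
                      ≈-refl X C P (coreSum K)) ⟩
  X ⊗ C ⊕ (P ⊗ (1⊖X ⊗ (1P ⊕ X ⊗ coreSum K)) ⊖ 1⊖X ⊗ P)
    ≈⟨ ≈[]-⊕-congˡ (X ⊗ C) (≈[]-⊕-congʳ (neg (1⊖X ⊗ P))
         (≈[]-NonNegX-⊗ (NonNegX-qxP K) (1⊖X⊗[1⊕X⊗coreSum] K M≤K N≤K))) ⟩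
  X ⊗ C ⊕ (P ⊗ (X ⊗ invSum K) ⊖ 1⊖X ⊗ P)
    ≡⟨ cong (λ u → X ⊗ C ⊕ (P ⊗ (X ⊗ invSum K) ⊖ 1⊖X ⊗ u ⊗ P)) (sym X⊗xpow-1) ⟩
  X ⊗ C ⊕ (P ⊗ (X ⊗ invSum K) ⊖ 1⊖X ⊗ (X ⊗ xpow -[1+ 0 ]) ⊗ P)
    ≈⟨ ≈⇒≈[] (solve 5 (λ x C P B y → x :* C :+ (P :* (x :* B) :- (con (+ 1) :- x) :* (x :* y) :* P)
                         := x :* (P :* B :- (con (+ 1) :- x) :* y :* P :+ C))
                      ≈-refl X C P (invSum K) (xpow -[1+ 0 ])) ⟩
  X ⊗ (P ⊗ invSum K ⊖ 1⊖X ⊗ xpow -[1+ 0 ] ⊗ P ⊕ C)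
    ≡⟨⟩
  X ⊗ RHStrunc K
    ∎
  where
  open ≈[]-Reasoning N M
  C = correctionTerm K
  P = qxP K

coeff-≡-from-X⊗ : ∀ N m p r → X ⊗ p ≈[ + N , m + + 1 ] X ⊗ r → coeff N m p ≡ coeff N m r
coeff-≡-from-X⊗ N m p r X⊗p≈X⊗r = begin
  coeff N m p                         ≡⟨ coeff≡coeffℤ N m p ⟩
  coeffℤ (+ N) m p                    ≡⟨ cong (λ L → coeffℤ (+ N) L p) (m+1-1≡m m) ⟨
  coeffℤ (+ N) (m + + 1 - + 1) p      ≡⟨ coeffℤ-xpow-⊗ (+ N) (m + + 1) (+ 1) p ⟨
  coeffℤ (+ N) (m + + 1) (X ⊗ p)      ≡⟨ coeffℤ-≡-below X⊗p≈X⊗r ℤP.≤-refl ℤP.≤-refl ⟩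
  coeffℤ (+ N) (m + + 1) (X ⊗ r)      ≡⟨ coeffℤ-xpow-⊗ (+ N) (m + + 1) (+ 1) r ⟩
  coeffℤ (+ N) (m + + 1 - + 1) r      ≡⟨ cong (λ L → coeffℤ (+ N) L r) (m+1-1≡m m) ⟩
  coeffℤ (+ N) m r                    ≡⟨ coeff≡coeffℤ N m r ⟨
  coeff N m r                         ∎
  where
  open ≡-Reasoning
  m+1-1≡m : ∀ m → m + + 1 - + 1 ≡ m
  m+1-1≡m = solve-∀

i≤+∣i∣ : ∀ i → i ℤ.≤ + ℤ.∣ i ∣
i≤+∣i∣ (+ n)    = ℤP.≤-refl
i≤+∣i∣ -[1+ n ] = ℤ.-≤+

lemma2p5 : (N : ℕ) (m : ℤ) → ∃ λ K₀ → (K : ℕ) → K₀ ≤ K →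
             coeff N m (Gtrunc K) ≡ coeff N m (RHStrunc K)
lemma2p5 N m = K₀ , λ K K₀≤K →
  coeff-≡-from-X⊗ N m (Gtrunc K) (RHStrunc K)
    (X⊗Gtrunc≈X⊗RHStrunc K (ℤP.≤-trans m+1≤K₀ (ℤ.+≤+ K₀≤K)) (ℤ.+≤+ (ℕP.≤-trans N≤K₀ K₀≤K)))
  where
  K₀ = N ℕ.+ ℤ.∣ m ∣ ℕ.+ 1
  N≤K₀ : N ℕ.≤ K₀
  N≤K₀ = ℕP.≤-trans (ℕP.m≤m+n N ℤ.∣ m ∣) (ℕP.m≤m+n _ 1)
  m+1≤K₀ : m + + 1 ℤ.≤ + K₀
  m+1≤K₀ = ℤP.≤-trans (ℤP.+-monoˡ-≤ (+ 1) (i≤+∣i∣ m)) (ℤ.+≤+ (ℕP.+-monoˡ-≤ 1 (ℕP.m≤n+m ℤ.∣ m ∣ N)))
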